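{- Let $n$ be a positive integer with $2\mid\sigma(n)$ and $\sigma(n)>2n$. Then $n$ is neither near superperfect nor deficient superperfect.
   Context: $\sigma(m)$ denotes the sum of the positive divisors of $m$. A positive integer $n$ is near superperfect if $2n+d=\sigma(\sigma(n))$ for some positive divisor $d$ of $n$, and deficient superperfect if $2n-d=\sigma(\sigma(n))$ for some positive divisor $d$ of $n$. -}

module Defs where

open import Data.Nat using (ℕ; suc; _+_; _*_; _∸_; _<_)
open import Data.Nat.Divisibility using (_∣_; _∣?_)
open import Data.Nat.ListAction using (sum)
open import Data.List using (List; filter; upTo; map)
open import Data.Product using (∃; _×_)
open import Relation.Binary.PropositionalEquality using (_≡_)

-- the divisors of m that lie in {1,…,m}; for m ≥ 1 these are exactly its positive divisors
-- (σ 0 = 0 by this convention; only σ at positive arguments is used)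
divisors : ℕ → List ℕ
divisors m = filter (_∣? m) (map suc (upTo m))

σ : ℕ → ℕ
σ m = sum (divisors m)

NearSuperperfect : ℕ → Set
NearSuperperfect n = ∃ λ d → 0 < d × d ∣ n × 2 * n + d ≡ σ (σ n)

-- n is deficient superperfect: 2n − d = σ(σ(n)) for some positive divisor d of n
-- (d ∣ n with n ≥ 1 gives d ≤ n < 2n, so truncated subtraction is exact)
DeficientSuperperfect : ℕ → Set
DeficientSuperperfect n = ∃ λ d → 0 < d × d ∣ n × 2 * n ∸ d ≡ σ (σ n)

{-# OPTIONS --safe #-}
module Submission where

open import Defs
open import Data.Nat using (ℕ; suc; _+_; _*_; _≤_; _<_; _≤′_; ≤′-refl; ≤′-step; z≤n; s≤s; >-nonZero)
open import Data.Nat.Properties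
open import Data.Nat.Divisibility using (_∣_; _∣?_; divides; ∣-refl; ∣⇒≤)
open import Data.Nat.ListAction using (sum)
open import Data.Nat.ListAction.Properties using (sum-++)
open import Data.List using ([]; [_]; _++_; _∷ʳ_; filter; upTo; map)
open import Data.List.Properties using (upTo-∷ʳ; map-++; filter-++; filter-accept)
open import Data.Product using (_×_; _,_)
open import Relation.Binary.PropositionalEquality using (_≡_; refl; sym; trans; cong; subst; module ≡-Reasoning)
open import Relation.Nullary using (¬_)

-- Write σ(n) = 2q. Then q > n, and q < 2q are both divisors of σ(n), so
-- σ(σ(n)) ≥ 3q > 3n. A near superperfect n has σ(σ(n)) = 2n + d ≤ 3n, and a
-- deficient superperfect n has σ(σ(n)) = 2n − d ≤ 2n.

divisorSumUpTo : ℕ → ℕ → ℕ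
divisorSumUpTo m j = sum (filter (_∣? m) (map suc (upTo j)))

divisorSumUpTo-suc : ∀ m j →
  divisorSumUpTo m (suc j) ≡ divisorSumUpTo m j + sum (filter (_∣? m) [ suc j ])
divisorSumUpTo-suc m j = begin
  sum (filter (_∣? m) (map suc (upTo (suc j))))
    ≡⟨ cong (λ xs → sum (filter (_∣? m) (map suc xs))) (sym (upTo-∷ʳ j)) ⟩
  sum (filter (_∣? m) (map suc (upTo j ∷ʳ j)))
    ≡⟨ cong (λ xs → sum (filter (_∣? m) xs)) (map-++ suc (upTo j) [ j ]) ⟩
  sum (filter (_∣? m) (map suc (upTo j) ++ [ suc j ]))
    ≡⟨ cong sum (filter-++ (_∣? m) (map suc (upTo j)) [ suc j ]) ⟩
  sum (filter (_∣? m) (map suc (upTo j)) ++ filter (_∣? m) [ suc j ])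
    ≡⟨ sum-++ (filter (_∣? m) (map suc (upTo j))) (filter (_∣? m) [ suc j ]) ⟩
  divisorSumUpTo m j + sum (filter (_∣? m) [ suc j ]) ∎
  where open ≡-Reasoning

divisorSumUpTo-≤-suc : ∀ m j → divisorSumUpTo m j ≤ divisorSumUpTo m (suc j)
divisorSumUpTo-≤-suc m j rewrite divisorSumUpTo-suc m j = m≤m+n _ _

divisorSumUpTo-mono : ∀ m {j k} → j ≤′ k → divisorSumUpTo m j ≤ divisorSumUpTo m k
divisorSumUpTo-mono m ≤′-refl = ≤-refl
divisorSumUpTo-mono m (≤′-step {k} j≤′k) =
  ≤-trans (divisorSumUpTo-mono m j≤′k) (divisorSumUpTo-≤-suc m k)

divisorSumUpTo-suc-divisor : ∀ m j → suc j ∣ m →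
  divisorSumUpTo m j + suc j ≡ divisorSumUpTo m (suc j)
divisorSumUpTo-suc-divisor m j sj∣m
  rewrite divisorSumUpTo-suc m j | filter-accept (_∣? m) {xs = []} sj∣m | +-identityʳ (suc j) = refl

divisorPair≤σ : ∀ {m a b} → 0 < m → 0 < a → a < b → a ∣ m → b ∣ m → a + b ≤ σ m
divisorPair≤σ {m} {suc i} {suc j} m>0 _ (s≤s i<j) a∣m b∣m = begin
  suc i + suc j
    ≤⟨ +-monoˡ-≤ (suc j) (m≤n+m (suc i) (divisorSumUpTo m i)) ⟩
  divisorSumUpTo m i + suc i + suc j
    ≡⟨ cong (_+ suc j) (divisorSumUpTo-suc-divisor m i a∣m) ⟩
  divisorSumUpTo m (suc i) + suc j
    ≤⟨ +-monoˡ-≤ (suc j) (divisorSumUpTo-mono m (≤⇒≤′ i<j)) ⟩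
  divisorSumUpTo m j + suc j
    ≡⟨ divisorSumUpTo-suc-divisor m j b∣m ⟩
  divisorSumUpTo m (suc j)
    ≤⟨ divisorSumUpTo-mono m (≤⇒≤′ (∣⇒≤ {{>-nonZero m>0}} b∣m)) ⟩
  σ m ∎
  where open ≤-Reasoning

3n<σσn : ∀ {n} → 2 ∣ σ n → 2 * n < σ n → 3 * n < σ (σ n)
3n<σσn {n} (divides q σn≡q*2) 2n<σn = begin-strict
  n + 2 * n <⟨ +-mono-< n<q 2n<σn ⟩
  q + σ n   ≤⟨ divisorPair≤σ (<-≤-trans q>0 (<⇒≤ q<σn)) q>0 q<σn q∣σn ∣-refl ⟩
  σ (σ n)   ∎
  where
  open ≤-Reasoning
  σn≡2q : σ n ≡ 2 * q
  σn≡2q = trans σn≡q*2 (*-comm q 2)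
  n<q : n < q
  n<q = *-cancelˡ-< 2 n q (subst (2 * n <_) σn≡2q 2n<σn)
  q>0 : 0 < q
  q>0 = ≤-<-trans z≤n n<q
  q<σn : q < σ n
  q<σn = subst (q <_) (sym σn≡q*2) (m<m*n q 2 {{>-nonZero q>0}} (s≤s (s≤s z≤n)))
  q∣σn : q ∣ σ n
  q∣σn = divides 2 σn≡2q

nearSuperperfect⇒σσ≤3n : ∀ {n} → 0 < n → NearSuperperfect n → σ (σ n) ≤ 3 * n
nearSuperperfect⇒σσ≤3n {n} n>0 (d , _ , d∣n , 2n+d≡σσn) = begin
  σ (σ n)   ≡⟨ sym 2n+d≡σσn ⟩
  2 * n + d ≤⟨ +-monoʳ-≤ (2 * n) (∣⇒≤ {{>-nonZero n>0}} d∣n) ⟩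
  2 * n + n ≡⟨ +-comm (2 * n) n ⟩
  3 * n     ∎
  where open ≤-Reasoning

deficientSuperperfect⇒σσ≤2n : ∀ {n} → DeficientSuperperfect n → σ (σ n) ≤ 2 * n
deficientSuperperfect⇒σσ≤2n {n} (d , _ , _ , 2n∸d≡σσn) = subst (_≤ 2 * n) 2n∸d≡σσn (m∸n≤m (2 * n) d)

mainTheorem12 : (n : ℕ) → 0 < n → 2 ∣ σ n → 2 * n < σ n →
                  ¬ NearSuperperfect n × ¬ DeficientSuperperfect n
mainTheorem12 n n>0 2∣σn 2n<σn = notNear , notDeficient
  where
  3n<σσ : 3 * n < σ (σ n)
  3n<σσ = 3n<σσn {n} 2∣σn 2n<σn
  notNear : ¬ NearSuperperfect n
  notNear near = <⇒≱ 3n<σσ (nearSuperperfect⇒σσ≤3n n>0 near)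
  notDeficient : ¬ DeficientSuperperfect n
  notDeficient deficient =
    <⇒≱ 3n<σσ (≤-trans (deficientSuperperfect⇒σσ≤2n deficient) (m≤n+m (2 * n) n))
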